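{- Let $I$ be an instance of $\textsc{MinSumC}$ in which every program has cost $c_1$ or $c_2$, where $c_1<c_2$ are non-negative integers, and every agent has a nonempty preference list. Let $M$ be the matching output by the algorithm described in the context on $I$, and let ${\sf OPT}$ be an $\mathcal{A}$-perfect envy-free matching of $I$ of minimum cost. Then $c(M)\le \ell_a\cdot c({\sf OPT})$, where $\ell_a=\max_{a\in\mathcal{A}}|\mathcal{N}(a)|$.
   Context: $\textsc{MinSumC}$ instance: a finite set $\mathcal{A}$ of agents, a finite set $\mathcal{P}$ of programs, a set $E\subseteq \mathcal{A}\times\mathcal{P}$ of mutually acceptable pairs; $\mathcal{N}(a)=\{p:(a,p)\in E\}$, $\mathcal{N}(p)=\{a:(a,p)\in E\}$. Each agent $a$ has a strict preference order $\succ_a$ on $\mathcal{N}(a)$, each program $p$ a strict preference order $\succ_p$ on $\mathcal{N}(p)$, and each program a non-negative integer cost $c(p)$ (initial quotas are $0$, so programs have no capacity limits). A matching is a set $M\subseteq E$ in which every agent occurs in at most one pair; $M(a)$ is $a$'s partner or $\bot$ if unmatched, and every $p\in\mathcal{N}(a)$ satisfies $p\succ_a\bot$. $M$ is envy-free if there are no $(a,p)\in M$ and $a'\in\mathcal{N}(p)$ with $a'\succ_p a$ and $p\succ_{a'}M(a')$. $M$ is $\mathcal{A}$-perfect if every agent is matched. Its cost is $c(M)=\sum_{(a,p)\in M}c(p)$. Dual variables: $y_a$ for each agent $a$, and $z_{a',p,a}\ge 0$ for each valid triplet $(a',p,a)$, i.e. $(a',p),(a,p)\in E$ with $a'\succ_p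 a$. For $(a,p)\in E$ let $\mathrm{lhs}(a,p)=y_a+\sum_{p'\in\mathcal{N}(a):\,p'=p\text{ or }p\succ_a p'}\ \sum_{a''\in\mathcal{N}(p'):\,a\succ_{p'}a''} z_{a,p',a''}-\sum_{a''\in\mathcal{N}(p):\,a''\succ_p a} z_{a'',p,a}$, $slack(a,p)=c(p)-\mathrm{lhs}(a,p)$; $(a,p)$ is tight if $slack(a,p)=0$. For the current matching $M$, $thresh(p)$ is the $\succ_p$-most-preferred agent $a\in\mathcal{N}(p)$ with $p\succ_a M(a)$, or $\bot$ if none. An edge $(a,p)\notin M$ is matchable if it is tight and $a=thresh(p)$. Free-promotions routine: while some matchable edge $(b,q)$ exists, remove $b$'s edge from $M$ (if any), add $(b,q)$, and recompute all thresholds. Algorithm: (1) $M=\emptyset$, all $y_a=c_1$, all $z=0$. (2) For each agent $a$ having a cost-$c_1$ program in $\mathcal{N}(a)$, add $(a,p)$ to $M$ where $p$ is $a$'s most-preferred cost-$c_1$ program. (3) Compute thresholds. (4) While $M$ is not $\mathcal{A}$-perfect: pick an unmatched agent $a$; while $a$ is unmatched: set $y_a\leftarrow y_a+c_2-c_1$; if a matchable edge is incident on $a$, add $a$'s most-preferred matchable edge to $M$, run free-promotions and recompute thresholds; otherwise let $\mathcal{P}(a)=\{p\in\mathcal{N}(a): p\succ_a M(a),\ (a,p)\text{ tight},\ thresh(p)\ne a\}$ and while $\mathcal{P}(a)\neq\emptyset$: choose an agent $a'$ that is the threshold of some program in $\mathcal{P}(a)$, let $\mathcal{P}(a,a')$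 be the programs of $\mathcal{P}(a)$ with threshold $a'$, let $p$ be $a'$'s least-preferred program in $\mathcal{P}(a,a')$, set $z_{a',p,a}=c_2-c_1$, let $(a',p')$ be the most-preferred matchable edge incident on $a'$, unmatch $a'$ if matched and add $(a',p')$ to $M$, run free-promotions, recompute thresholds and $\mathcal{P}(a)$. (5) Return $M$. -}

module Defs where

open import Data.Nat as ℕ using (ℕ; zero; suc; _<_; _≤_; _<ᵇ_; _⊔_)
open import Data.Integer as ℤ using (ℤ; +_; 0ℤ)
open import Data.Fin as Fin using (Fin)
open import Data.Bool using (Bool; true; false; if_then_else_; _∧_; _∨_)
open import Data.Maybe using (Maybe; just; nothing; maybe)
open import Data.List using (List; map; foldr; allFin)
open import Data.Nat.ListAction using (sum)
open import Data.Product using (Σ; ∃; _×_; _,_)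
open import Data.Unit using (⊤)
open import Relation.Nullary using (¬_)
open import Relation.Nullary.Decidable using (⌊_⌋)
open import Relation.Binary.PropositionalEquality using (_≡_; _≢_)

-- A MinSumC instance (initial quotas 0, so no capacities).
-- Strict preferences are given by rank functions (smaller rank = more
-- preferred), required injective on the respective neighbourhoods:
--   p ≻_a q  iff  rankA a p < rankA a q,
--   a ≻_p b  iff  rankP p a < rankP p b.

record Instance : Set where
  field
    nA nP : ℕ
    E     : Fin nA → Fin nP → Bool
    rankA : Fin nA → Fin nP → ℕ
    rankP : Fin nP → Fin nA → ℕ
    rankA-inj : ∀ a p q → E a p ≡ true → E a q ≡ true →
                rankA a p ≡ rankA a q → p ≡ q
    rankP-inj : ∀ p a b → E a p ≡ true → E b p ≡ true →
                rankP p a ≡ rankP p b → a ≡ b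
    cost  : Fin nP → ℕ

ΣZ : List ℤ → ℤ
ΣZ = foldr ℤ._+_ 0ℤ

module _ (I : Instance) where
  open Instance I

  Mat : Set
  Mat = Fin nA → Maybe (Fin nP)

  IsMatching : Mat → Set
  IsMatching M = ∀ a p → M a ≡ just p → E a p ≡ true

  -- p ≻_a m, where m is a program or ⊥ (every acceptable p beats ⊥)
  PrefA : Fin nA → Fin nP → Maybe (Fin nP) → Set
  PrefA a p nothing  = ⊤
  PrefA a p (just q) = rankA a p < rankA a q

  APerfect : Mat → Set
  APerfect M = ∀ a → ∃ λ p → M a ≡ just p

  EnvyFree : Mat → Set
  EnvyFree M = ∀ a p a' → M a ≡ just p → E a' p ≡ true →
               rankP p a' < rankP p a → ¬ PrefA a' p (M a')

  costM : Mat → ℕ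
  costM M = sum (map (λ a → maybe cost 0 (M a)) (allFin nA))

  degree : Fin nA → ℕ
  degree a = sum (map (λ p → if E a p then 1 else 0) (allFin nP))

  ℓA : ℕ
  ℓA = foldr _⊔_ 0 (map degree (allFin nA))

  IsOPT : Mat → Set
  IsOPT O = IsMatching O × APerfect O × EnvyFree O ×
            (∀ M → IsMatching M → APerfect M → EnvyFree M → costM O ≤ costM M)

  update : Mat → Fin nA → Maybe (Fin nP) → Mat
  update M a v b = if ⌊ b Fin.≟ a ⌋ then v else M b

  module Alg (c1 c2 : ℕ) where

    record State : Set where
      constructor ⟨_,_,_⟩
      field
        M : Mat
        y : Fin nA → ℤ
        z : Fin nA → Fin nP → Fin nA → ℤ   -- z a' p a (only valid triplets used)
    open State public

    δ : ℤ
    δ = + c2 ℤ.- + c1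

    lhs : State → Fin nA → Fin nP → ℤ
    lhs s a p =
      (y s a ℤ.+
        ΣZ (map (λ p' →
          if E a p' ∧ (⌊ p' Fin.≟ p ⌋ ∨ (rankA a p <ᵇ rankA a p'))
          then ΣZ (map (λ a'' →
                  if E a'' p' ∧ (rankP p' a <ᵇ rankP p' a'')
                  then z s a p' a'' else 0ℤ) (allFin nA))
          else 0ℤ) (allFin nP)))
      ℤ.- ΣZ (map (λ a'' →
             if E a'' p ∧ (rankP p a'' <ᵇ rankP p a)
             then z s a'' p a else 0ℤ) (allFin nA))

    slack : State → Fin nA → Fin nP → ℤ
    slack s a p = + cost p ℤ.- lhs s a p

    Tight : State → Fin nA → Fin nP → Set
    Tight s a p = slack s a p ≡ 0ℤ

    -- thresh(p) = a  (thresholds depend only on the current matching)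
    IsThresh : Mat → Fin nP → Fin nA → Set
    IsThresh M p a = E a p ≡ true × PrefA a p (M a) ×
      (∀ a' → E a' p ≡ true → PrefA a' p (M a') → rankP p a ≤ rankP p a')

    Matchable : State → Fin nA → Fin nP → Set
    Matchable s a p = E a p ≡ true × M s a ≢ just p × Tight s a p ×
                      IsThresh (M s) p a

    MostPrefMatchable : State → Fin nA → Fin nP → Set
    MostPrefMatchable s a p = Matchable s a p ×
      (∀ p' → Matchable s a p' → rankA a p ≤ rankA a p')

    setM : State → Fin nA → Fin nP → State
    setM s a p = ⟨ update (M s) a (just p) , y s , z s ⟩

    data FP : State → State → Set where
      fp-done : ∀ {s} → (∀ b q → ¬ Matchable s b q) → FP s s
      fp-step : ∀ {s s'} b q → Matchable s b q → FP (setM s b q) s' → FP s s'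

    InP : State → Fin nA → Fin nP → Set
    InP s a p = E a p ≡ true × PrefA a p (M s a) × Tight s a p ×
                ¬ IsThresh (M s) p a

    setZ : State → Fin nA → Fin nP → Fin nA → ℤ → State
    setZ s a' p a v = ⟨ M s , y s ,
      (λ b q c → if ⌊ b Fin.≟ a' ⌋ ∧ ⌊ q Fin.≟ p ⌋ ∧ ⌊ c Fin.≟ a ⌋
                 then v else z s b q c) ⟩

    incY : State → Fin nA → State
    incY s a = ⟨ M s , (λ b → if ⌊ b Fin.≟ a ⌋ then y s b ℤ.+ δ else y s b) , z s ⟩

    data InnerZ (a : Fin nA) : State → State → Set where
      iz-done : ∀ {s} → (∀ p → ¬ InP s a p) → InnerZ a s s
      iz-step : ∀ {s s2 s3} a' p p' →
        InP s a p → IsThresh (M s) p a' →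
        (∀ p'' → InP s a p'' → IsThresh (M s) p'' a' → rankA a' p'' ≤ rankA a' p) →
        MostPrefMatchable (setZ s a' p a δ) a' p' →
        FP (setM (setZ s a' p a δ) a' p') s2 →
        InnerZ a s2 s3 → InnerZ a s s3

    data Body (a : Fin nA) : State → State → Set where
      body-match : ∀ {s s2} p →
        MostPrefMatchable (incY s a) a p →
        FP (setM (incY s a) a p) s2 → Body a s s2
      body-z : ∀ {s s2} →
        (∀ p → ¬ Matchable (incY s a) a p) →
        InnerZ a (incY s a) s2 → Body a s s2

    data Serve (a : Fin nA) : State → State → Set where
      sv-done : ∀ {s} p → M s a ≡ just p → Serve a s s
      sv-iter : ∀ {s s2 s3} → M s a ≡ nothing → Body a s s2 → Serve a s2 s3 →
                Serve a s s3

    data Outer : State → State → Set where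
      out-done : ∀ {s} → APerfect (M s) → Outer s s
      out-step : ∀ {s s' s''} a → M s a ≡ nothing → Serve a s s' →
                 Outer s' s'' → Outer s s''

    InitM : Mat → Set
    InitM M0 = ∀ a →
      (M0 a ≡ nothing × (∀ p → E a p ≡ true → cost p ≢ c1)) ⊎′
      (Σ (Fin nP) λ p → M0 a ≡ just p × E a p ≡ true × cost p ≡ c1 ×
         (∀ p' → E a p' ≡ true → cost p' ≡ c1 → rankA a p ≤ rankA a p'))
      where open import Data.Sum using () renaming (_⊎_ to _⊎′_)

    initState : Mat → State
    initState M0 = ⟨ M0 , (λ _ → + c1) , (λ _ _ _ → 0ℤ) ⟩

    AlgRun : State → Set
    AlgRun s = Σ Mat λ M0 → InitM M0 × Outer (initState M0) s

{-# OPTIONS --safe #-}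
module Submission where

-- Throughout a run the duals (y, z) satisfy: every z-value is 0
-- or δ = c₂ − c₁, every edge has slack 0 or δ (so the duals are feasible), matched edges are
-- tight, and zIn b p = Σ_{a'} z_{a',p,b} ≤ y_b − c₁ on every edge, because each z_{a',p,b} := δ
-- is paid for by the raises of y_b that made (b,p) tight.  Two bounds then give the theorem.
-- Σ_b y_b ≤ c(OPT): sum the dual constraints over the edges of OPT; envy-freeness of OPT makes
-- every z_{a',p,b} subtracted at the OPT-edge of b reappear positively at the OPT-edge of a'.
-- c(M) ≤ ℓ_a Σ_b y_b: sum the tight constraints over the edges of M; the positive z-terms are at
-- most the total Σ_b Σ_{p ∈ 𝒩(b)} zIn b p, hence
-- c(M) ≤ Σ_b (y_b + (|𝒩(b)| − 1)(y_b − c₁)) ≤ ℓ_a Σ_b y_b.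

open import Defs

module PrimalDualAnalysis where

  open import Data.Nat as ℕ using (ℕ; zero; suc; s≤s; z≤n; _<ᵇ_; _⊔_)
  import Data.Nat.Properties as ℕP
  import Data.Nat.ListAction as ℕList
  open import Data.Integer as ℤ using (ℤ; +_; 0ℤ; _+_; _-_; _*_; -_; _≤_; +≤+)
  import Data.Integer.Properties as ℤP
  open import Data.Integer.Tactic.RingSolver using (solve-∀)
  open import Data.Fin as Fin using (Fin; punchIn)
  import Data.Fin.Properties as FinP
  open import Data.Bool using (Bool; true; false; if_then_else_; _∧_; _∨_)
  open import Data.List using (_∷_; map; foldr; allFin; tabulate)
  open import Data.List.Properties using (map-tabulate)
  open import Data.List.Membership.Propositional using (_∈_)
  open import Data.List.Membership.Propositional.Properties using (∈-map⁺; ∈-allFin)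
  open import Data.List.Relation.Unary.Any using (here; there)
  open import Data.Maybe using (just; nothing; maybe)
  open import Data.Product using (∃; _×_; _,_; proj₁; proj₂)
  open import Data.Sum using (_⊎_; inj₁; inj₂)
  open import Data.Unit using (tt)
  open import Data.Empty using (⊥-elim)
  open import Data.Bool.Properties using (T-≡; ∨-zeroʳ; ∧-conicalˡ; ∧-conicalʳ)
  open import Function using (id; _∘_; Equivalence)
  open import Relation.Nullary using (¬_; yes; no)
  open import Relation.Binary.Definitions using (tri<; tri≈; tri>)
  open import Relation.Nullary.Decidable using (⌊_⌋; toSum)
  open import Relation.Binary.PropositionalEquality
  open import Algebra.Properties.Semiring.Sum ℤP.+-*-semiring
    using (sum; sum-cong-≗; sum-replicate-zero; sum-remove; ∑-distrib-+; ∑-comm; *-distribˡ-sum; *-distribʳ-sum)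

  -- Finite sums over Fin n

  ΣZ-allFin : ∀ {n} (f : Fin n → ℤ) → ΣZ (map f (allFin n)) ≡ sum f
  ΣZ-allFin f = trans (cong ΣZ (map-tabulate id f)) (ΣZ-tabulate f)
    where
    ΣZ-tabulate : ∀ {m} (g : Fin m → ℤ) → ΣZ (tabulate g) ≡ sum g
    ΣZ-tabulate {zero}  g = refl
    ΣZ-tabulate {suc m} g = cong (λ t → g Fin.zero + t) (ΣZ-tabulate (g ∘ Fin.suc))

  ℕsum-allFin : ∀ {n} (f : Fin n → ℕ) → + ℕList.sum (map f (allFin n)) ≡ sum (λ i → + f i)
  ℕsum-allFin f = trans (cong (+_ ∘ ℕList.sum) (map-tabulate id f)) (sum-tabulate f)
    where
    sum-tabulate : ∀ {m} (g : Fin m → ℕ) → + ℕList.sum (tabulate g) ≡ sum (λ i → + g i)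
    sum-tabulate {zero}  g = refl
    sum-tabulate {suc m} g = cong (λ t → + g Fin.zero + t) (sum-tabulate (g ∘ Fin.suc))

  ≤-foldr-⊔ : ∀ {x xs} → x ∈ xs → x ℕ.≤ foldr _⊔_ 0 xs
  ≤-foldr-⊔ (here refl) = ℕP.m≤m⊔n _ _
  ≤-foldr-⊔ {xs = y ∷ _} (there x∈xs) = ℕP.≤-trans (≤-foldr-⊔ x∈xs) (ℕP.m≤n⊔m y _)

  ∑-zero : ∀ {n} {f : Fin n → ℤ} → (∀ i → f i ≡ 0ℤ) → sum f ≡ 0ℤ
  ∑-zero {n} f≡0 = trans (sum-cong-≗ f≡0) (sum-replicate-zero n)

  ∑-mono-≤ : ∀ {n} {f g : Fin n → ℤ} → (∀ i → f i ≤ g i) → sum f ≤ sum g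
  ∑-mono-≤ {zero}  f≤g = ℤP.≤-refl
  ∑-mono-≤ {suc n} f≤g = ℤP.+-mono-≤ (f≤g Fin.zero) (∑-mono-≤ (f≤g ∘ Fin.suc))

  ∑-nonneg : ∀ {n} {f : Fin n → ℤ} → (∀ i → 0ℤ ≤ f i) → 0ℤ ≤ sum f
  ∑-nonneg {n} {f} 0≤f = subst (_≤ sum f) (∑-zero {n} (λ _ → refl)) (∑-mono-≤ 0≤f)

  ∑-neg : ∀ {n} (f : Fin n → ℤ) → sum (λ i → - f i) ≡ - sum f
  ∑-neg {zero}  f = refl
  ∑-neg {suc n} f = trans (cong (λ t → - f Fin.zero + t) (∑-neg (f ∘ Fin.suc)))
                          (sym (ℤP.neg-distrib-+ (f Fin.zero) (sum (f ∘ Fin.suc))))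

  ∑-distrib-sub : ∀ {n} (f g : Fin n → ℤ) → sum (λ i → f i - g i) ≡ sum f - sum g
  ∑-distrib-sub f g = trans (∑-distrib-+ f (λ i → - g i)) (cong (λ t → sum f + t) (∑-neg g))

  ∑-if : ∀ {n} (c : Bool) (f : Fin n → ℤ) → sum (λ i → if c then f i else 0ℤ) ≡ (if c then sum f else 0ℤ)
  ∑-if true  f = refl
  ∑-if {n} false f = ∑-zero {n} (λ _ → refl)

  ∑-comm₃ : ∀ {l m n} (f : Fin l → Fin m → Fin n → ℤ) →
            sum (λ i → sum (λ j → sum (λ k → f i j k))) ≡ sum (λ k → sum (λ j → sum (λ i → f i j k)))
  ∑-comm₃ f = begin
    sum (λ i → sum (λ j → sum (λ k → f i j k)))   ≡⟨ sum-cong-≗ (λ i → ∑-comm (f i)) ⟩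
    sum (λ i → sum (λ k → sum (λ j → f i j k)))   ≡⟨ ∑-comm (λ i k → sum (λ j → f i j k)) ⟩
    sum (λ k → sum (λ i → sum (λ j → f i j k)))   ≡⟨ sum-cong-≗ (λ k → ∑-comm (λ i j → f i j k)) ⟩
    sum (λ k → sum (λ j → sum (λ i → f i j k)))   ∎
    where open ≡-Reasoning

  sum-minus-term : ∀ {n} (f : Fin (suc n) → ℤ) i → sum f - f i ≡ sum (λ j → f (punchIn i j))
  sum-minus-term f i = trans (cong (_- f i) (sum-remove {i = i} f)) (cancel (f i) _)
    where
    cancel : ∀ x r → x + r - x ≡ r
    cancel = solve-∀

  ≤-∑ : ∀ {n} {f : Fin n → ℤ} → (∀ i → 0ℤ ≤ f i) → ∀ i → f i ≤ sum f
  ≤-∑ {suc n} {f} 0≤f i = subst (f i ≤_) (sym (sum-remove {i = i} f))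
    (ℤP.i≤i+j (f i) _ ⦃ ℤ.nonNegative (∑-nonneg (0≤f ∘ punchIn i)) ⦄)

  ∑-update : ∀ {n} {f g : Fin n → ℤ} i {d} → f i ≡ g i + d → (∀ j → j ≢ i → f j ≡ g j) →
             sum f ≡ sum g + d
  ∑-update {suc n} {f} {g} i {d} fi≡gi+d f≡g = begin
    sum f                                        ≡⟨ sum-remove {i = i} f ⟩
    f i + sum (λ j → f (punchIn i j))             ≡⟨ cong₂ _+_ fi≡gi+d (sum-cong-≗ (λ j → f≡g _ (FinP.punchInᵢ≢i i j))) ⟩
    g i + d + sum (λ j → g (punchIn i j))         ≡⟨ swap (g i) d _ ⟩
    g i + sum (λ j → g (punchIn i j)) + d         ≡⟨ cong (_+ d) (sum-remove {i = i} g) ⟨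
    sum g + d                                    ∎
    where
    open ≡-Reasoning
    swap : ∀ x y z → x + y + z ≡ x + z + y
    swap = solve-∀

  ∑-minus-term-mono-≤ : ∀ {n} {f g : Fin n → ℤ} → (∀ i → f i ≤ g i) → ∀ i → sum f - f i ≤ sum g - g i
  ∑-minus-term-mono-≤ {suc n} {f} {g} f≤g i = subst₂ _≤_ (sym (sum-minus-term f i)) (sym (sum-minus-term g i))
    (∑-mono-≤ (f≤g ∘ punchIn i))

  -- With k = Y - c, the gap is (ℓ - d) Y + (d - 1) c ≥ 0.
  degree-weighted-bound : ∀ {c d ℓ : ℕ} {Y : ℤ} → + c ≤ Y → 1 ℕ.≤ d → d ℕ.≤ ℓ →
                          Y + (+ d * (Y - + c) - (Y - + c)) ≤ + ℓ * Y
  degree-weighted-bound {c} {suc d} {ℓ} {+ n} (+≤+ _) (s≤s z≤n) d≤ℓ with ℕP.m≤n⇒∃[o]m+o≡n d≤ℓ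
  ... | e , refl = begin
    Y + (+ suc d * K - K)                        ≤⟨ ℤP.i≤i+j _ (+ (e ℕ.* n ℕ.+ d ℕ.* c)) ⟩
    Y + (+ suc d * K - K) + + (e ℕ.* n ℕ.+ d ℕ.* c)
      ≡⟨ cong (λ t → Y + (+ suc d * K - K) + t) (cong₂ _+_ (ℤP.pos-* e n) (ℤP.pos-* d c)) ⟩
    Y + (+ suc d * K - K) + (+ e * Y + + d * + c) ≡⟨ gap Y (+ c) (+ d) (+ e) ⟩
    + (suc d ℕ.+ e) * Y                          ∎
    where
    open ℤP.≤-Reasoning
    Y : ℤ
    Y = + n
    K : ℤ
    K = Y - + c
    gap : ∀ Y C D E → Y + ((ℤ.1ℤ + D) * (Y - C) - (Y - C)) + (E * Y + D * C) ≡ (ℤ.1ℤ + D + E) * Y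
    gap = solve-∀

  ⌊≟⌋-refl : ∀ {n} (i : Fin n) → ⌊ i Fin.≟ i ⌋ ≡ true
  ⌊≟⌋-refl i with i Fin.≟ i
  ... | yes _  = refl
  ... | no i≢i = ⊥-elim (i≢i refl)

  ⌊≟⌋-≢ : ∀ {n} {i j : Fin n} → i ≢ j → ⌊ i Fin.≟ j ⌋ ≡ false
  ⌊≟⌋-≢ {i = i} {j} i≢j with i Fin.≟ j
  ... | yes i≡j = ⊥-elim (i≢j i≡j)
  ... | no _    = refl

  guarded-cong : ∀ (c : Bool) {x x' : ℤ} → x ≡ x' → (if c then x else 0ℤ) ≡ (if c then x' else 0ℤ)
  guarded-cong c = cong (λ t → if c then t else 0ℤ)

  ∑-guarded-zero : ∀ {n} (c : Fin n → Bool) {f : Fin n → ℤ} → (∀ i → f i ≡ 0ℤ) →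
                   sum (λ i → if c i then f i else 0ℤ) ≡ 0ℤ
  ∑-guarded-zero c f≡0 = ∑-zero (λ i → trans (guarded-cong (c i) (f≡0 i)) (guarded-0 (c i)))
    where
    guarded-0 : ∀ b → (if b then 0ℤ else 0ℤ) ≡ 0ℤ
    guarded-0 true  = refl
    guarded-0 false = refl

  <ᵇ-true : ∀ {m n} → m ℕ.< n → (m <ᵇ n) ≡ true
  <ᵇ-true m<n = Equivalence.to T-≡ (ℕP.<⇒<ᵇ m<n)

  <ᵇ-sound : ∀ {m n} → (m <ᵇ n) ≡ true → m ℕ.< n
  <ᵇ-sound m<ᵇn = ℕP.<ᵇ⇒< _ _ (Equivalence.from T-≡ m<ᵇn)

  guarded-nonneg : ∀ (c : Bool) {x : ℤ} → 0ℤ ≤ x → 0ℤ ≤ (if c then x else 0ℤ)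
  guarded-nonneg true  0≤x = 0≤x
  guarded-nonneg false _   = ℤP.≤-refl

  -- The dual constraints

  module _ (I : Instance) (c1 c2 : ℕ) where
    open Instance I
    open Alg I c1 c2

    DualZ : Set
    DualZ = Fin nA → Fin nP → Fin nA → ℤ

    zOut : DualZ → Fin nA → Fin nP → ℤ
    zOut z a p = sum (λ a'' → if E a'' p ∧ (rankP p a <ᵇ rankP p a'') then z a p a'' else 0ℤ)

    zIn : DualZ → Fin nA → Fin nP → ℤ
    zIn z a p = sum (λ a'' → if E a'' p ∧ (rankP p a'' <ᵇ rankP p a) then z a'' p a else 0ℤ)

    atOrBelowᵇ : Fin nA → Fin nP → Fin nP → Bool
    atOrBelowᵇ a p p' = E a p' ∧ (⌊ p' Fin.≟ p ⌋ ∨ (rankA a p <ᵇ rankA a p'))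

    atOrBelow-intro : ∀ {a p p'} → E a p' ≡ true → p' ≡ p ⊎ rankA a p ℕ.< rankA a p' →
                      atOrBelowᵇ a p p' ≡ true
    atOrBelow-intro {a} {p} {p'} ap'∈E (inj₁ refl) rewrite ap'∈E | ⌊≟⌋-refl p = refl
    atOrBelow-intro {a} {p} {p'} ap'∈E (inj₂ p≻p') rewrite ap'∈E | <ᵇ-true p≻p' = ∨-zeroʳ _

    atOrBelow-elim : ∀ {a p p'} → atOrBelowᵇ a p p' ≡ true → p' ≡ p ⊎ rankA a p ℕ.< rankA a p'
    atOrBelow-elim {a} {p} {p'} below with E a p' | p' Fin.≟ p | rankA a p <ᵇ rankA a p' in p≻p'
    ... | true | yes p'≡p | _    = inj₁ p'≡p
    ... | true | no _     | true = inj₂ (<ᵇ-sound p≻p')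

    atOrBelow-false : ∀ {a p p'} → rankA a p' ℕ.< rankA a p → atOrBelowᵇ a p p' ≡ false
    atOrBelow-false {a} {p} {p'} p'≻p with atOrBelowᵇ a p p' in below
    ... | false = refl
    ... | true with atOrBelow-elim {a} {p} {p'} below
    ...   | inj₁ refl  = ⊥-elim (ℕP.<-irrefl refl p'≻p)
    ...   | inj₂ p≻p'  = ⊥-elim (ℕP.<-asym p≻p' p'≻p)

    zOutBelow : DualZ → Fin nA → Fin nP → ℤ
    zOutBelow z a p = sum (λ p' → if atOrBelowᵇ a p p' then zOut z a p' else 0ℤ)

    zOutBelow-zero : ∀ {z : DualZ} a p → (∀ q c → z a q c ≡ 0ℤ) → zOutBelow z a p ≡ 0ℤ
    zOutBelow-zero a p z≡0 =
      ∑-guarded-zero (atOrBelowᵇ a p) (λ p' → ∑-guarded-zero (λ c → E c p' ∧ (rankP p' a <ᵇ rankP p' c)) (z≡0 p'))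

    zIn-zero : ∀ {z : DualZ} a p → (∀ q c → z c q a ≡ 0ℤ) → zIn z a p ≡ 0ℤ
    zIn-zero a p z≡0 = ∑-guarded-zero (λ c → E c p ∧ (rankP p c <ᵇ rankP p a)) (z≡0 p)

    zOutBelow-cong : ∀ {z z' : DualZ} a p → (∀ b q c → z b q c ≡ z' b q c) → zOutBelow z a p ≡ zOutBelow z' a p
    zOutBelow-cong a p z≡z' = sum-cong-≗ {nP} (λ p' → guarded-cong (atOrBelowᵇ a p p')
      (sum-cong-≗ {nA} (λ c → guarded-cong (E c p' ∧ (rankP p' a <ᵇ rankP p' c)) (z≡z' a p' c))))

    zIn-cong : ∀ {z z' : DualZ} a p → (∀ b q c → z b q c ≡ z' b q c) → zIn z a p ≡ zIn z' a p
    zIn-cong a p z≡z' = sum-cong-≗ {nA} (λ c → guarded-cong (E c p ∧ (rankP p c <ᵇ rankP p a)) (z≡z' c p a))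

    lhs≡ : ∀ s a p → lhs s a p ≡ y s a + zOutBelow (z s) a p - zIn (z s) a p
    lhs≡ s a p = cong₂ (λ u v → y s a + u - v)
      (trans (ΣZ-allFin {nP} _)
             (sum-cong-≗ (λ p' → cong (λ t → if atOrBelowᵇ a p p' then t else 0ℤ) (ΣZ-allFin {nA} _))))
      (ΣZ-allFin {nA} _)

    lhs-cong : ∀ {s s'} a p → y s a ≡ y s' a → zOutBelow (z s) a p ≡ zOutBelow (z s') a p →
               zIn (z s) a p ≡ zIn (z s') a p → lhs s a p ≡ lhs s' a p
    lhs-cong {s} {s'} a p y≡ out≡ in≡ = begin
      lhs s a p                                          ≡⟨ lhs≡ s a p ⟩
      y s a + zOutBelow (z s) a p - zIn (z s) a p        ≡⟨ cong₂ _-_ (cong₂ _+_ y≡ out≡) in≡ ⟩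
      y s' a + zOutBelow (z s') a p - zIn (z s') a p     ≡⟨ lhs≡ s' a p ⟨
      lhs s' a p                                         ∎
      where open ≡-Reasoning

    slack-cong : ∀ {s s' a p} → lhs s a p ≡ lhs s' a p → slack s a p ≡ slack s' a p
    slack-cong {p = p} = cong (λ t → + cost p - t)

    tight-cong : ∀ {s s' a p} → lhs s a p ≡ lhs s' a p → Tight s a p → Tight s' a p
    tight-cong {s} {s'} {a} {p} lhs≡lhs' = trans (sym (slack-cong {s} {s'} {a} {p} lhs≡lhs'))

    tight-after-raise : ∀ {s s' a p} → lhs s' a p ≡ lhs s a p + δ → slack s a p ≡ δ → Tight s' a p
    tight-after-raise {s} {s'} {a} {p} lhs'≡ slack≡δ = begin
      + cost p - lhs s' a p          ≡⟨ cong (λ t → + cost p - t) lhs'≡ ⟩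
      + cost p - (lhs s a p + δ)     ≡⟨ shift (+ cost p) (lhs s a p) δ ⟩
      slack s a p - δ                ≡⟨ cong (_- δ) slack≡δ ⟩
      δ - δ                          ≡⟨ ℤP.+-inverseʳ δ ⟩
      0ℤ                             ∎
      where
      open ≡-Reasoning
      shift : ∀ c l d → c - (l + d) ≡ (c - l) - d
      shift = solve-∀

    δ-slack-after-lower : ∀ {s s' a p} → lhs s' a p ≡ lhs s a p - δ → Tight s a p → slack s' a p ≡ δ
    δ-slack-after-lower {s} {s'} {a} {p} lhs'≡ tight = begin
      + cost p - lhs s' a p          ≡⟨ cong (λ t → + cost p - t) lhs'≡ ⟩
      + cost p - (lhs s a p - δ)     ≡⟨ shift (+ cost p) (lhs s a p) δ ⟩
      slack s a p + δ                ≡⟨ cong (_+ δ) tight ⟩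
      0ℤ + δ                         ≡⟨ ℤP.+-identityˡ δ ⟩
      δ                              ∎
      where
      open ≡-Reasoning
      shift : ∀ c l d → c - (l - d) ≡ (c - l) + d
      shift = solve-∀

    y-incY-self : ∀ s a → y (incY s a) a ≡ y s a + δ
    y-incY-self s a rewrite ⌊≟⌋-refl a = refl

    y-incY-other : ∀ s {a b} → b ≢ a → y (incY s a) b ≡ y s b
    y-incY-other s b≢a rewrite ⌊≟⌋-≢ b≢a = refl

    lhs-incY-self : ∀ s a q → lhs (incY s a) a q ≡ lhs s a q + δ
    lhs-incY-self s a q = begin
      lhs (incY s a) a q                               ≡⟨ lhs≡ (incY s a) a q ⟩
      y (incY s a) a + Out - In                        ≡⟨ cong (λ t → t + Out - In) (y-incY-self s a) ⟩
      y s a + δ + Out - In                             ≡⟨ shift (y s a) δ Out In ⟩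
      y s a + Out - In + δ                             ≡⟨ cong (_+ δ) (lhs≡ s a q) ⟨
      lhs s a q + δ                                    ∎
      where
      open ≡-Reasoning
      Out : ℤ
      Out = zOutBelow (z s) a q
      In : ℤ
      In = zIn (z s) a q
      shift : ∀ y d o i → y + d + o - i ≡ y + o - i + d
      shift = solve-∀

    lhs-incY-other : ∀ s {a b} q → b ≢ a → lhs (incY s a) b q ≡ lhs s b q
    lhs-incY-other s {a} {b} q b≢a = lhs-cong {incY s a} {s} b q (y-incY-other s b≢a) refl refl

    module SetZ (s : State) (a' : Fin nA) (p : Fin nP) (a : Fin nA) where

      s' : State
      s' = setZ s a' p a δ

      z-hit : z s' a' p a ≡ δ
      z-hit rewrite ⌊≟⌋-refl a' | ⌊≟⌋-refl p | ⌊≟⌋-refl a = refl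

      z-miss : ∀ {b q c} → b ≢ a' ⊎ q ≢ p ⊎ c ≢ a → z s' b q c ≡ z s b q c
      z-miss {b} {q} {c} miss with b Fin.≟ a' | q Fin.≟ p | c Fin.≟ a
      ... | no _     | _        | _        = refl
      ... | yes _    | no _     | _        = refl
      ... | yes _    | yes _    | no _     = refl
      ... | yes refl | yes refl | yes refl with miss
      ...   | inj₁ a'≢a'        = ⊥-elim (a'≢a' refl)
      ...   | inj₂ (inj₁ p≢p)   = ⊥-elim (p≢p refl)
      ...   | inj₂ (inj₂ a≢a)   = ⊥-elim (a≢a refl)

      z-unchanged : z s a' p a ≡ δ → ∀ b q c → z s' b q c ≡ z s b q c
      z-unchanged z≡δ b q c with b Fin.≟ a' | q Fin.≟ p | c Fin.≟ a
      ... | no _     | _        | _        = refl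
      ... | yes _    | no _     | _        = refl
      ... | yes _    | yes _    | no _     = refl
      ... | yes refl | yes refl | yes refl = sym z≡δ

      module ValidTriplet (a'≢a : a' ≢ a) (a'p∈E : E a' p ≡ true) (ap∈E : E a p ≡ true)
                   (a'≻a : rankP p a' ℕ.< rankP p a) (z≡0 : z s a' p a ≡ 0ℤ) where

        valid-term : ∀ {b} → E b p ≡ true →
          (if E b p ∧ (rankP p a' <ᵇ rankP p a) then z s' a' p a else 0ℤ) ≡
          (if E b p ∧ (rankP p a' <ᵇ rankP p a) then z s a' p a else 0ℤ) + δ
        valid-term bp∈E rewrite bp∈E | <ᵇ-true a'≻a | z-hit | z≡0 = sym (ℤP.+-identityˡ δ)

        zIn-hit : zIn (z s') a p ≡ zIn (z s) a p + δ
        zIn-hit = ∑-update a' (valid-term a'p∈E)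
          (λ b b≢a' → guarded-cong _ (z-miss (inj₁ b≢a')))

        zIn-miss : ∀ {b q} → b ≢ a ⊎ q ≢ p → zIn (z s') b q ≡ zIn (z s) b q
        zIn-miss (inj₁ b≢a) = sum-cong-≗ {nA} (λ c → guarded-cong _ (z-miss (inj₂ (inj₂ b≢a))))
        zIn-miss (inj₂ q≢p) = sum-cong-≗ {nA} (λ c → guarded-cong _ (z-miss (inj₂ (inj₁ q≢p))))

        zOut-hit : zOut (z s') a' p ≡ zOut (z s) a' p + δ
        zOut-hit = ∑-update a (valid-term ap∈E)
          (λ c c≢a → guarded-cong _ (z-miss (inj₂ (inj₂ c≢a))))

        zOutBelow-hit : ∀ q → zOutBelow (z s') a' q ≡ zOutBelow (z s) a' q + (if atOrBelowᵇ a' q p then δ else 0ℤ)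
        zOutBelow-hit q = ∑-update p term
          (λ p' p'≢p → guarded-cong (atOrBelowᵇ a' q p') (sum-cong-≗ {nA} (λ c → guarded-cong _ (z-miss (inj₂ (inj₁ p'≢p))))))
          where
          term : (if atOrBelowᵇ a' q p then zOut (z s') a' p else 0ℤ) ≡
                 (if atOrBelowᵇ a' q p then zOut (z s) a' p else 0ℤ) + (if atOrBelowᵇ a' q p then δ else 0ℤ)
          term with atOrBelowᵇ a' q p
          ... | true  = zOut-hit
          ... | false = refl

        zOutBelow-miss : ∀ {b} q → b ≢ a' → zOutBelow (z s') b q ≡ zOutBelow (z s) b q
        zOutBelow-miss {b} q b≢a' = sum-cong-≗ {nP} (λ p' → guarded-cong (atOrBelowᵇ b q p')
          (sum-cong-≗ {nA} (λ c → guarded-cong _ (z-miss (inj₁ b≢a')))))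

        lhs-served-p : lhs s' a p ≡ lhs s a p - δ
        lhs-served-p = begin
          lhs s' a p                                       ≡⟨ lhs≡ s' a p ⟩
          y s a + zOutBelow (z s') a p - zIn (z s') a p
            ≡⟨ cong₂ (λ o i → y s a + o - i) (zOutBelow-miss p (a'≢a ∘ sym)) zIn-hit ⟩
          y s a + zOutBelow (z s) a p - (zIn (z s) a p + δ) ≡⟨ shift (y s a) _ _ δ ⟩
          y s a + zOutBelow (z s) a p - zIn (z s) a p - δ  ≡⟨ cong (_- δ) (lhs≡ s a p) ⟨
          lhs s a p - δ                                    ∎
          where
          open ≡-Reasoning
          shift : ∀ y o i d → y + o - (i + d) ≡ y + o - i - d
          shift = solve-∀

        lhs-served : ∀ {q} → q ≢ p → lhs s' a q ≡ lhs s a q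
        lhs-served {q} q≢p = lhs-cong {s'} {s} a q refl (zOutBelow-miss q (a'≢a ∘ sym)) (zIn-miss (inj₂ q≢p))

        lhs-thresh : ∀ q → lhs s' a' q ≡ lhs s a' q + (if atOrBelowᵇ a' q p then δ else 0ℤ)
        lhs-thresh q = begin
          lhs s' a' q                                          ≡⟨ lhs≡ s' a' q ⟩
          y s a' + zOutBelow (z s') a' q - zIn (z s') a' q
            ≡⟨ cong₂ (λ o i → y s a' + o - i) (zOutBelow-hit q) (zIn-miss (inj₁ a'≢a)) ⟩
          y s a' + (zOutBelow (z s) a' q + Δ) - zIn (z s) a' q ≡⟨ shift (y s a') _ _ Δ ⟩
          y s a' + zOutBelow (z s) a' q - zIn (z s) a' q + Δ   ≡⟨ cong (_+ Δ) (lhs≡ s a' q) ⟨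
          lhs s a' q + Δ                                       ∎
          where
          open ≡-Reasoning
          Δ : ℤ
          Δ = if atOrBelowᵇ a' q p then δ else 0ℤ
          shift : ∀ y o i d → y + (o + d) - i ≡ y + o - i + d
          shift = solve-∀

        lhs-other : ∀ {b} q → b ≢ a' → b ≢ a → lhs s' b q ≡ lhs s b q
        lhs-other {b} q b≢a' b≢a = lhs-cong {s'} {s} b q refl (zOutBelow-miss q b≢a') (zIn-miss (inj₁ b≢a))

    -- Invariants of a run

    Pristine : State → Fin nA → Set
    Pristine s b = M s b ≡ nothing →
      y s b ≡ + c1 × (∀ q c → z s b q c ≡ 0ℤ) × (∀ q c → z s c q b ≡ 0ℤ)

    TightDownward : State → Fin nA → Set
    TightDownward s b = ∀ q r → E b q ≡ true → E b r ≡ true → rankA b q ℕ.< rankA b r →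
                        PrefA I b r (M s b) → Tight s b q → Tight s b r

    NoMatchable : State → Set
    NoMatchable s = ∀ b q → ¬ Matchable s b q

    record Inv (s : State) : Set where
      field
        z-0-or-δ      : ∀ b q c → z s b q c ≡ 0ℤ ⊎ z s b q c ≡ δ
        c1≤y          : ∀ b → + c1 ≤ y s b
        matching      : IsMatching I (M s)
        zIn≤y-c1      : ∀ b q → E b q ≡ true → zIn (z s) b q ≤ y s b - + c1
        matched-tight : ∀ b q → M s b ≡ just q → Tight s b q
        slack-0-or-δ  : ∀ b q → E b q ≡ true → slack s b q ≡ 0ℤ ⊎ slack s b q ≡ δ
        unmatched-c2  : ∀ b → M s b ≡ nothing → ∀ q → E b q ≡ true → cost q ≡ c2

    not-tight⇒δ : ∀ {s b q} → Inv s → E b q ≡ true → ¬ Tight s b q → slack s b q ≡ δ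
    not-tight⇒δ J bq∈E not-tight with Inv.slack-0-or-δ J _ _ bq∈E
    ... | inj₁ tight = ⊥-elim (not-tight tight)
    ... | inj₂ slack≡δ = slack≡δ

    record ServingInv (a : Fin nA) (s : State) : Set where
      field
        inv          : Inv s
        others       : ∀ b → b ≢ a → Pristine s b × TightDownward s b
        served-z≡0 : ∀ q c → z s a q c ≡ 0ℤ
        served-c2    : ∀ q → E a q ≡ true → cost q ≡ c2

    record OuterInv (s : State) : Set where
      field
        inv   : Inv s
        every : ∀ b → Pristine s b × TightDownward s b

    pref-trans : ∀ b {r q} m → rankA b r ℕ.< rankA b q → PrefA I b q m → PrefA I b r m
    pref-trans b nothing  r≻q _   = tt
    pref-trans b (just _) r≻q q≻m = ℕP.<-trans r≻q q≻m

    pref⇒≢ : ∀ b {p} m → PrefA I b p m → m ≢ just p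
    pref⇒≢ b (just _) p≻p refl = ℕP.<-irrefl refl p≻p

    just≢nothing : ∀ {A : Set} {x : A} → just x ≢ nothing
    just≢nothing ()

    update-self : ∀ (m : Mat I) b v → update I m b v b ≡ v
    update-self m b v rewrite ⌊≟⌋-refl b = refl

    update-other : ∀ (m : Mat I) {b b'} v → b' ≢ b → update I m b v b' ≡ m b'
    update-other m v b'≢b rewrite ⌊≟⌋-≢ b'≢b = refl

    module Promote {s : State} {b : Fin nA} {q : Fin nP} (mt : Matchable s b q) where
      private
        bq∈E : E b q ≡ true
        bq∈E = proj₁ mt
        bq-tight : Tight s b q
        bq-tight = proj₁ (proj₂ (proj₂ mt))
        q≻Mb : PrefA I b q (M s b)
        q≻Mb = proj₁ (proj₂ (proj₂ (proj₂ (proj₂ mt))))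

      inv : Inv s → Inv (setM s b q)
      inv J = record
        { z-0-or-δ = z-0-or-δ ; c1≤y = c1≤y ; zIn≤y-c1 = zIn≤y-c1 ; slack-0-or-δ = slack-0-or-δ
        ; matching = matching′ ; matched-tight = matched-tight′ ; unmatched-c2 = unmatched-c2′ }
        where
        open Inv J
        matching′ : IsMatching I (M (setM s b q))
        matching′ b' q' Mb'≡q' with b' Fin.≟ b
        matching′ b' q' refl   | yes refl = bq∈E
        matching′ b' q' Mb'≡q' | no _     = matching b' q' Mb'≡q'
        matched-tight′ : ∀ b' q' → M (setM s b q) b' ≡ just q' → Tight s b' q'
        matched-tight′ b' q' Mb'≡q' with b' Fin.≟ b
        matched-tight′ b' q' refl   | yes refl = bq-tight
        matched-tight′ b' q' Mb'≡q' | no _     = matched-tight b' q' Mb'≡q'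
        unmatched-c2′ : ∀ b' → M (setM s b q) b' ≡ nothing → ∀ q' → E b' q' ≡ true → cost q' ≡ c2
        unmatched-c2′ b' Mb'≡⊥ with b' Fin.≟ b
        ... | yes refl = ⊥-elim (just≢nothing Mb'≡⊥)
        ... | no _     = unmatched-c2 b' Mb'≡⊥

      pristine : ∀ {b'} → Pristine s b' → Pristine (setM s b q) b'
      pristine {b'} P Mb'≡⊥ with b' Fin.≟ b
      ... | yes refl = ⊥-elim (just≢nothing Mb'≡⊥)
      ... | no _     = P Mb'≡⊥

      tightDownward : ∀ {b'} → TightDownward s b' → TightDownward (setM s b q) b'
      tightDownward {b'} T q₁ r q₁∈E r∈E q₁≻r r≻Mb' with b' Fin.≟ b
      ... | yes refl = T q₁ r q₁∈E r∈E q₁≻r (pref-trans b (M s b) r≻Mb' q≻Mb)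
      ... | no _     = T q₁ r q₁∈E r∈E q₁≻r r≻Mb'

      serving : ∀ {a} → ServingInv a s → ServingInv a (setM s b q)
      serving S = record
        { inv = inv (ServingInv.inv S)
        ; others = λ b' b'≢a → let P , T = ServingInv.others S b' b'≢a in pristine P , tightDownward T
        ; served-z≡0 = ServingInv.served-z≡0 S
        ; served-c2 = ServingInv.served-c2 S }

    free-promotions : ∀ {a s s'} → ServingInv a s → FP s s' → ServingInv a s' × NoMatchable s'
    free-promotions S (fp-done none)        = S , none
    free-promotions S (fp-step b q mt rest) = free-promotions (Promote.serving mt S) rest

    free-promotions-lhs : ∀ {s s'} → FP s s' → ∀ b q → lhs s' b q ≡ lhs s b q
    free-promotions-lhs (fp-done _)          b q = refl
    free-promotions-lhs (fp-step _ _ _ rest) b q = free-promotions-lhs rest b q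

    free-promotions-matched : ∀ {s s' b q} → FP s s' → M s b ≡ just q → ∃ λ q' → M s' b ≡ just q'
    free-promotions-matched (fp-done _) Mb≡q = _ , Mb≡q
    free-promotions-matched {s} {b = b} (fp-step b' q' _ rest) Mb≡q with b Fin.≟ b'
    ... | yes refl = free-promotions-matched rest (update-self (M s) b (just q'))
    ... | no b≢b'  = free-promotions-matched rest (trans (update-other (M s) (just q') b≢b') Mb≡q)

    module _ (c1≤c2 : c1 ℕ.≤ c2) where

      0≤δ : 0ℤ ≤ δ
      0≤δ = ℤP.i≤j⇒0≤j-i (+≤+ c1≤c2)

      ≤+δ : ∀ x → x ≤ x + δ
      ≤+δ x = ℤP.i≤i+j x δ ⦃ ℤ.nonNegative 0≤δ ⦄

      module RaiseY {a s} (S : ServingInv a s) (a-unmatched : M s a ≡ nothing)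
                    (a-slack : ∀ q → E a q ≡ true → slack s a q ≡ δ) where
        open ServingInv S
        open Inv inv

        s' : State
        s' = incY s a

        all-tight : ∀ q → E a q ≡ true → Tight s' a q
        all-tight q aq∈E = tight-after-raise {s} {s'} {a} {q} (lhs-incY-self s a q) (a-slack q aq∈E)

        inv′ : Inv s'
        inv′ = record
          { z-0-or-δ = z-0-or-δ ; matching = matching ; unmatched-c2 = unmatched-c2
          ; c1≤y = c1≤y′ ; zIn≤y-c1 = zIn≤y-c1′ ; matched-tight = matched-tight′ ; slack-0-or-δ = slack-0-or-δ′ }
          where
          c1≤y′ : ∀ b → + c1 ≤ y s' b
          c1≤y′ b with toSum (b Fin.≟ a)
          ... | inj₁ refl = subst (+ c1 ≤_) (sym (y-incY-self s a)) (ℤP.≤-trans (c1≤y a) (≤+δ (y s a)))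
          ... | inj₂ b≢a   = subst (+ c1 ≤_) (sym (y-incY-other s b≢a)) (c1≤y b)
          zIn≤y-c1′ : ∀ b q → E b q ≡ true → zIn (z s') b q ≤ y s' b - + c1
          zIn≤y-c1′ b q bq∈E with toSum (b Fin.≟ a)
          ... | inj₁ refl = subst (λ t → zIn (z s) a q ≤ t - + c1) (sym (y-incY-self s a))
                (ℤP.≤-trans (zIn≤y-c1 a q bq∈E) (subst (y s a - + c1 ≤_) (shift (y s a) δ (+ c1)) (≤+δ _)))
            where
            shift : ∀ y d c → y - c + d ≡ y + d - c
            shift = solve-∀
          ... | inj₂ b≢a   = subst (λ t → zIn (z s) b q ≤ t - + c1) (sym (y-incY-other s b≢a)) (zIn≤y-c1 b q bq∈E)
          matched-tight′ : ∀ b q → M s b ≡ just q → Tight s' b q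
          matched-tight′ b q Mb≡q with toSum (b Fin.≟ a)
          ... | inj₁ refl = ⊥-elim (just≢nothing (trans (sym Mb≡q) a-unmatched))
          ... | inj₂ b≢a   = tight-cong {s} {s'} {b} {q} (sym (lhs-incY-other s q b≢a)) (matched-tight b q Mb≡q)
          slack-0-or-δ′ : ∀ b q → E b q ≡ true → slack s' b q ≡ 0ℤ ⊎ slack s' b q ≡ δ
          slack-0-or-δ′ b q bq∈E with toSum (b Fin.≟ a)
          ... | inj₁ refl = inj₁ (all-tight q bq∈E)
          ... | inj₂ b≢a   rewrite slack-cong {s'} {s} {b} {q} (lhs-incY-other s q b≢a) = slack-0-or-δ b q bq∈E

        serving : ServingInv a s'
        serving = record
          { inv = inv′ ; served-z≡0 = served-z≡0 ; served-c2 = served-c2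
          ; others = λ b b≢a → let P , T = others b b≢a in pristine b≢a P , tightDownward b≢a T }
          where
          pristine : ∀ {b} → b ≢ a → Pristine s b → Pristine s' b
          pristine b≢a P Mb≡⊥ = let y≡ , out , in′ = P Mb≡⊥ in trans (y-incY-other s b≢a) y≡ , out , in′
          tightDownward : ∀ {b} → b ≢ a → TightDownward s b → TightDownward s' b
          tightDownward {b} b≢a T q r q∈E r∈E q≻r r≻Mb q-tight =
            tight-cong {s} {s'} {b} {r} (sym (lhs-incY-other s r b≢a))
              (T q r q∈E r∈E q≻r r≻Mb (tight-cong {s'} {s} {b} {q} (lhs-incY-other s q b≢a) q-tight))

        noMatchable-others : NoMatchable s → ∀ b q → b ≢ a → ¬ Matchable s' b q
        noMatchable-others none b q b≢a (bq∈E , q≠Mb , tight , thresh) =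
          none b q (bq∈E , q≠Mb , tight-cong {s'} {s} {b} {q} (lhs-incY-other s q b≢a) tight , thresh)

      module RaiseZ {a s a' p p'} (S : ServingInv a s) (none : NoMatchable s) (p∈𝒫 : InP s a p)
                    (thresh : IsThresh (M s) p a') (best : MostPrefMatchable (setZ s a' p a δ) a' p') where
        open ServingInv S
        open Inv inv
        open SetZ s a' p a

        s'' : State
        s'' = setM s' a' p'

        ap∈E : E a p ≡ true
        ap∈E = proj₁ p∈𝒫
        p≻Ma : PrefA I a p (M s a)
        p≻Ma = proj₁ (proj₂ p∈𝒫)
        ap-tight : Tight s a p
        ap-tight = proj₁ (proj₂ (proj₂ p∈𝒫))
        a'p∈E : E a' p ≡ true
        a'p∈E = proj₁ thresh
        p≻Ma' : PrefA I a' p (M s a')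
        p≻Ma' = proj₁ (proj₂ thresh)

        a'≢a : a' ≢ a
        a'≢a refl = proj₂ (proj₂ (proj₂ p∈𝒫)) thresh

        a'≻a : rankP p a' ℕ.< rankP p a
        a'≻a = ℕP.≤∧≢⇒< (proj₂ (proj₂ thresh) a ap∈E p≻Ma) (a'≢a ∘ rankP-inj p a' a a'p∈E ap∈E)

        -- If z_{a',p,a} were already δ, the update would change nothing and (a',p') would be matchable in s.
        z≡0 : z s a' p a ≡ 0ℤ
        z≡0 with z-0-or-δ a' p a
        ... | inj₁ z≡0 = z≡0
        ... | inj₂ z≡δ =
          let a'p'∈E , p'≠Ma' , tight , thr = proj₁ best
          in ⊥-elim (none a' p' (a'p'∈E , p'≠Ma' , tight-cong {s'} {s} {a'} {p'} unchanged tight , thr))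
          where
          unchanged : lhs s' a' p' ≡ lhs s a' p'
          unchanged = lhs-cong {s'} {s} a' p' refl (zOutBelow-cong a' p' (z-unchanged z≡δ))
                                                   (zIn-cong a' p' (z-unchanged z≡δ))

        open ValidTriplet a'≢a a'p∈E ap∈E a'≻a z≡0

        above-p-not-tight : ∀ {q} → E a' q ≡ true → atOrBelowᵇ a' q p ≡ true → ¬ Tight s a' q
        above-p-not-tight {q} a'q∈E q⪰p q-tight =
          none a' p (a'p∈E , pref⇒≢ a' (M s a') p≻Ma' , p-tight (atOrBelow-elim q⪰p) , thresh)
          where
          p-tight : p ≡ q ⊎ rankA a' q ℕ.< rankA a' p → Tight s a' p
          p-tight (inj₁ refl) = q-tight
          p-tight (inj₂ q≻p)  = proj₂ (others a' a'≢a) q p a'q∈E a'p∈E q≻p p≻Ma' q-tight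

        above-p-tight : ∀ {q} → E a' q ≡ true → atOrBelowᵇ a' q p ≡ true → Tight s' a' q
        above-p-tight {q} a'q∈E q⪰p = tight-after-raise {s} {s'} {a'} {q}
          (trans (lhs-thresh q) (cong (λ b → lhs s a' q + (if b then δ else 0ℤ)) q⪰p))
          (not-tight⇒δ inv a'q∈E (above-p-not-tight a'q∈E q⪰p))

        below-p-lhs : ∀ {q} → atOrBelowᵇ a' q p ≡ false → lhs s' a' q ≡ lhs s a' q
        below-p-lhs {q} q⋡p = trans (lhs-thresh q)
          (trans (cong (λ b → lhs s a' q + (if b then δ else 0ℤ)) q⋡p) (ℤP.+-identityʳ _))

        p'⪰p : rankA a' p' ℕ.≤ rankA a' p
        p'⪰p = proj₂ best p
          (a'p∈E , pref⇒≢ a' (M s a') p≻Ma' , above-p-tight a'p∈E (atOrBelow-intro a'p∈E (inj₁ refl)) , thresh)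

        served-p-zIn : zIn (z s) a p + δ ≡ y s a - + c1
        served-p-zIn = begin
          In + (+ c2 - + c1)                   ≡⟨ cong (λ c → In + (c - + c1)) c2≡ ⟩
          In + (y s a + 0ℤ - In - + c1)        ≡⟨ cancel In (y s a) (+ c1) ⟩
          y s a - + c1                         ∎
          where
          open ≡-Reasoning
          In : ℤ
          In = zIn (z s) a p
          cancel : ∀ i y c → i + (y + 0ℤ - i - c) ≡ y - c
          cancel = solve-∀
          c2≡ : + c2 ≡ y s a + 0ℤ - In
          c2≡ = begin
            + c2                                 ≡⟨ cong +_ (served-c2 p ap∈E) ⟨
            + cost p                             ≡⟨ ℤP.i-j≡0⇒i≡j _ _ ap-tight ⟩
            lhs s a p                            ≡⟨ lhs≡ s a p ⟩
            y s a + zOutBelow (z s) a p - In     ≡⟨ cong (λ o → y s a + o - In) (zOutBelow-zero {z s} a p served-z≡0) ⟩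
            y s a + 0ℤ - In                      ∎

        inv′ : Inv s'
        inv′ = record
          { c1≤y = c1≤y ; matching = matching ; unmatched-c2 = unmatched-c2
          ; z-0-or-δ = z-0-or-δ′ ; zIn≤y-c1 = zIn≤y-c1′ ; matched-tight = matched-tight′ ; slack-0-or-δ = slack-0-or-δ′ }
          where
          z-0-or-δ′ : ∀ b q c → z s' b q c ≡ 0ℤ ⊎ z s' b q c ≡ δ
          z-0-or-δ′ b q c with ⌊ b Fin.≟ a' ⌋ ∧ ⌊ q Fin.≟ p ⌋ ∧ ⌊ c Fin.≟ a ⌋
          ... | true  = inj₂ refl
          ... | false = z-0-or-δ b q c

          zIn≤y-c1′ : ∀ b q → E b q ≡ true → zIn (z s') b q ≤ y s b - + c1
          zIn≤y-c1′ b q bq∈E with toSum (b Fin.≟ a) | toSum (q Fin.≟ p)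
          ... | inj₁ refl | inj₁ refl = ℤP.≤-reflexive (trans zIn-hit served-p-zIn)
          ... | inj₁ refl | inj₂ q≢p  = subst (_≤ y s a - + c1) (sym (zIn-miss (inj₂ q≢p))) (zIn≤y-c1 a q bq∈E)
          ... | inj₂ b≢a  | _         = subst (_≤ y s b - + c1) (sym (zIn-miss (inj₁ b≢a))) (zIn≤y-c1 b q bq∈E)

          matched-tight′ : ∀ b q → M s b ≡ just q → Tight s' b q
          matched-tight′ b q Mb≡q with toSum (b Fin.≟ a') | toSum (b Fin.≟ a)
          ... | inj₁ refl | _ = tight-cong {s} {s'} {a'} {q} (sym (below-p-lhs (atOrBelow-false p≻q)))
                                  (matched-tight a' q Mb≡q)
            where
            p≻q : rankA a' p ℕ.< rankA a' q
            p≻q = subst (PrefA I a' p) Mb≡q p≻Ma'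
          ... | inj₂ _ | inj₁ refl = tight-cong {s} {s'} {a} {q} (sym (lhs-served q≢p)) (matched-tight a q Mb≡q)
            where
            q≢p : q ≢ p
            q≢p refl = pref⇒≢ a (M s a) p≻Ma Mb≡q
          ... | inj₂ b≢a' | inj₂ b≢a = tight-cong {s} {s'} {b} {q} (sym (lhs-other q b≢a' b≢a)) (matched-tight b q Mb≡q)

          slack-0-or-δ′ : ∀ b q → E b q ≡ true → slack s' b q ≡ 0ℤ ⊎ slack s' b q ≡ δ
          slack-0-or-δ′ b q bq∈E with toSum (b Fin.≟ a') | toSum (b Fin.≟ a)
          ... | inj₁ refl | _ with atOrBelowᵇ a' q p in q⪰p
          ...   | true  = inj₁ (above-p-tight bq∈E q⪰p)
          ...   | false rewrite slack-cong {s'} {s} {a'} {q} (below-p-lhs q⪰p) = slack-0-or-δ a' q bq∈E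
          slack-0-or-δ′ b q bq∈E | inj₂ _ | inj₁ refl with toSum (q Fin.≟ p)
          ...   | inj₁ refl = inj₂ (δ-slack-after-lower {s} {s'} {a} {p} lhs-served-p ap-tight)
          ...   | inj₂ q≢p rewrite slack-cong {s'} {s} {a} {q} (lhs-served q≢p) = slack-0-or-δ a q bq∈E
          slack-0-or-δ′ b q bq∈E | inj₂ b≢a' | inj₂ b≢a
            rewrite slack-cong {s'} {s} {b} {q} (lhs-other q b≢a' b≢a) = slack-0-or-δ b q bq∈E

        module P = Promote {s'} {a'} {p'} (proj₁ best)

        Ms''a'≡p' : M s'' a' ≡ just p'
        Ms''a'≡p' = update-self (M s) a' (just p')

        thresh-pristine : Pristine s'' a'
        thresh-pristine Ma'≡⊥ = ⊥-elim (just≢nothing (trans (sym Ms''a'≡p') Ma'≡⊥))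

        thresh-tightDownward : TightDownward s'' a'
        thresh-tightDownward q r _ a'r∈E _ r≻Ma' _ =
          above-p-tight a'r∈E (atOrBelow-intro a'p∈E (inj₂ (ℕP.<-≤-trans r≻p' p'⪰p)))
          where
          r≻p' : rankA a' r ℕ.< rankA a' p'
          r≻p' = subst (PrefA I a' r) Ms''a'≡p' r≻Ma'

        unrelated-pristine : ∀ {b} → b ≢ a' → b ≢ a → Pristine s b → Pristine s' b
        unrelated-pristine b≢a' b≢a P Mb≡⊥ =
          let y≡ , out , in′ = P Mb≡⊥
          in y≡ , (λ q c → trans (z-miss (inj₁ b≢a')) (out q c))
                , (λ q c → trans (z-miss (inj₂ (inj₂ b≢a))) (in′ q c))

        unrelated-tightDownward : ∀ {b} → b ≢ a' → b ≢ a → TightDownward s b → TightDownward s' b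
        unrelated-tightDownward {b} b≢a' b≢a T q r q∈E r∈E q≻r r≻Mb q-tight =
          tight-cong {s} {s'} {b} {r} (sym (lhs-other r b≢a' b≢a))
            (T q r q∈E r∈E q≻r r≻Mb (tight-cong {s'} {s} {b} {q} (lhs-other q b≢a' b≢a) q-tight))

        serving : ServingInv a s''
        serving = record
          { inv = P.inv inv′
          ; others = others″
          ; served-z≡0 = λ q c → trans (z-miss (inj₁ (a'≢a ∘ sym))) (served-z≡0 q c)
          ; served-c2 = served-c2 }
          where
          others″ : ∀ b → b ≢ a → Pristine s'' b × TightDownward s'' b
          others″ b b≢a with toSum (b Fin.≟ a')
          ... | inj₁ refl = thresh-pristine , thresh-tightDownward
          ... | inj₂ b≢a' = let P , T = others b b≢a
                            in P.pristine (unrelated-pristine b≢a' b≢a P)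
                             , P.tightDownward (unrelated-tightDownward b≢a' b≢a T)

      inner-loop : ∀ {a s s'} → ServingInv a s → NoMatchable s → InnerZ a s s' →
                   ServingInv a s' × NoMatchable s' × (∀ p → ¬ InP s' a p)
      inner-loop S none (iz-done 𝒫≡∅) = S , none , 𝒫≡∅
      inner-loop S none (iz-step _ _ _ p∈𝒫 thresh _ best fp rest) =
        let S' , none' = free-promotions (RaiseZ.serving S none p∈𝒫 thresh best) fp
        in inner-loop S' none' rest

      record ServeInv (a : Fin nA) (s : State) : Set where
        field
          serving         : ServingInv a s
          none            : NoMatchable s
          served-downward : TightDownward s a
          unmatched-slack : M s a ≡ nothing → ∀ q → E a q ≡ true → slack s a q ≡ δ

      body-step : ∀ {a s s₂} → ServeInv a s → M s a ≡ nothing → Body a s s₂ → ServeInv a s₂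
      body-step {a} {s} {s₂} R Ma≡⊥ (body-match p best fp) = record
        { serving = proj₁ result ; none = proj₂ result ; served-downward = downward ; unmatched-slack = matched }
        where
        open ServeInv R
        module Y = RaiseY serving Ma≡⊥ (unmatched-slack Ma≡⊥)
        fp′ : FP Y.s' s₂
        fp′ = fp-step a p (proj₁ best) fp
        result : ServingInv a s₂ × NoMatchable s₂
        result = free-promotions Y.serving fp′
        downward : TightDownward s₂ a
        downward _ r _ ar∈E _ _ _ = tight-cong {Y.s'} {s₂} {a} {r} (sym (free-promotions-lhs fp′ a r)) (Y.all-tight r ar∈E)
        matched : M s₂ a ≡ nothing → ∀ q → E a q ≡ true → slack s₂ a q ≡ δ
        matched Ma≡⊥′ = ⊥-elim (just≢nothing (trans (sym (proj₂ a-matched)) Ma≡⊥′))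
          where
            a-matched : ∃ λ q′ → M s₂ a ≡ just q′
            a-matched = free-promotions-matched fp (update-self (M Y.s') a (just p))
      body-step {a} {s} {s₂} R Ma≡⊥ (body-z no-match iz) = record
        { serving = S₂ ; none = none₂ ; served-downward = downward ; unmatched-slack = unmatched }
        where
        open ServeInv R
        module Y = RaiseY serving Ma≡⊥ (unmatched-slack Ma≡⊥)
        none-t : NoMatchable Y.s'
        none-t b q with toSum (b Fin.≟ a)
        ... | inj₁ refl = no-match q
        ... | inj₂ b≢a  = Y.noMatchable-others none b q b≢a
        result : ServingInv a s₂ × NoMatchable s₂ × (∀ p → ¬ InP s₂ a p)
        result = inner-loop Y.serving none-t iz
        S₂ : ServingInv a s₂
        S₂ = proj₁ result
        none₂ : NoMatchable s₂
        none₂ = proj₁ (proj₂ result)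
        -- A tight edge preferred to M(a) is not in 𝒫(a), so a is its threshold and it would be matchable.
        not-tight : ∀ q → E a q ≡ true → PrefA I a q (M s₂ a) → ¬ Tight s₂ a q
        not-tight q aq∈E q≻Ma tight =
          proj₂ (proj₂ result) q (aq∈E , q≻Ma , tight , λ th → none₂ a q (aq∈E , pref⇒≢ a (M s₂ a) q≻Ma , tight , th))
        downward : TightDownward s₂ a
        downward q r aq∈E _ q≻r r≻Ma q-tight = ⊥-elim (not-tight q aq∈E (pref-trans a (M s₂ a) q≻r r≻Ma) q-tight)
        unmatched : M s₂ a ≡ nothing → ∀ q → E a q ≡ true → slack s₂ a q ≡ δ
        unmatched Ma≡⊥′ q aq∈E =
          not-tight⇒δ (ServingInv.inv S₂) aq∈E (not-tight q aq∈E (subst (PrefA I a q) (sym Ma≡⊥′) tt))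

      serve-loop : ∀ {a s s₂} → ServeInv a s → Serve a s s₂ → OuterInv s₂ × NoMatchable s₂
      serve-loop {a} {s} R (sv-done p Ma≡p) = record { inv = ServingInv.inv serving ; every = every } , none
        where
        open ServeInv R
        every : ∀ b → Pristine s b × TightDownward s b
        every b with toSum (b Fin.≟ a)
        ... | inj₁ refl = (λ Ma≡⊥ → ⊥-elim (just≢nothing (trans (sym Ma≡p) Ma≡⊥))) , served-downward
        ... | inj₂ b≢a  = ServingInv.others serving b b≢a
      serve-loop R (sv-iter Ma≡⊥ body rest) = serve-loop (body-step R Ma≡⊥ body) rest

      start-serving : ∀ {a s} → OuterInv s → NoMatchable s → M s a ≡ nothing → ServeInv a s
      start-serving {a} {s} O none Ma≡⊥ = record
        { serving = record { inv = inv ; others = λ b _ → every b ; served-z≡0 = out≡0 ; served-c2 = unmatched-c2 a Ma≡⊥ }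
        ; none = none
        ; served-downward = downward
        ; unmatched-slack = λ _ → slack≡δ }
        where
        open OuterInv O
        open Inv inv
        y≡c1 : y s a ≡ + c1
        y≡c1 = proj₁ (proj₁ (every a) Ma≡⊥)
        out≡0 : ∀ q c → z s a q c ≡ 0ℤ
        out≡0 = proj₁ (proj₂ (proj₁ (every a) Ma≡⊥))
        in≡0 : ∀ q c → z s c q a ≡ 0ℤ
        in≡0 = proj₂ (proj₂ (proj₁ (every a) Ma≡⊥))
        slack≡δ : ∀ q → E a q ≡ true → slack s a q ≡ δ
        slack≡δ q aq∈E = begin
          + cost q - lhs s a q
            ≡⟨ cong₂ (λ c l → + c - l) (unmatched-c2 a Ma≡⊥ q aq∈E) (lhs≡ s a q) ⟩
          + c2 - (y s a + zOutBelow (z s) a q - zIn (z s) a q)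
            ≡⟨ cong (λ l → + c2 - l) (cong₂ (λ y o → y + o - zIn (z s) a q) y≡c1 (zOutBelow-zero {z s} a q out≡0)) ⟩
          + c2 - (+ c1 + 0ℤ - zIn (z s) a q)
            ≡⟨ cong (λ i → + c2 - (+ c1 + 0ℤ - i)) (zIn-zero {z s} a q in≡0) ⟩
          + c2 - (+ c1 + 0ℤ - 0ℤ)                                  ≡⟨ simplify (+ c2) (+ c1) ⟩
          δ                                                        ∎
          where
          open ≡-Reasoning
          simplify : ∀ c₂ c₁ → c₂ - (c₁ + 0ℤ - 0ℤ) ≡ c₂ - c₁
          simplify = solve-∀
        -- Every edge of a has slack δ, so a tight one forces δ = 0.
        downward : TightDownward s a
        downward q r aq∈E ar∈E _ _ q-tight = trans (slack≡δ r ar∈E) (trans (sym (slack≡δ q aq∈E)) q-tight)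

      outer-loop : ∀ {s s₂} → OuterInv s → NoMatchable s → Outer s s₂ → OuterInv s₂ × APerfect I (M s₂)
      outer-loop O none (out-done perfect) = O , perfect
      outer-loop O none (out-step a Ma≡⊥ serve rest) =
        let O' , none' = serve-loop (start-serving O none Ma≡⊥) serve
        in outer-loop O' none' rest

    module Initial (cost∈ : ∀ p → cost p ≡ c1 ⊎ cost p ≡ c2) (M₀ : Mat I) (init : InitM M₀) where

      s₀ : State
      s₀ = initState M₀

      slack₀ : ∀ b q → slack s₀ b q ≡ + cost q - + c1
      slack₀ b q = cong (λ l → + cost q - l) (begin
        lhs s₀ b q                                              ≡⟨ lhs≡ s₀ b q ⟩
        + c1 + zOutBelow (z s₀) b q - zIn (z s₀) b q
          ≡⟨ cong₂ (λ o i → + c1 + o - i) (zOutBelow-zero {z s₀} b q (λ _ _ → refl)) (zIn-zero {z s₀} b q (λ _ _ → refl)) ⟩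
        + c1 + 0ℤ - 0ℤ                                          ≡⟨ simplify (+ c1) ⟩
        + c1                                                    ∎)
        where
        open ≡-Reasoning
        simplify : ∀ c → c + 0ℤ - 0ℤ ≡ c
        simplify = solve-∀

      c1-tight : ∀ {b q} → cost q ≡ c1 → Tight s₀ b q
      c1-tight {b} {q} q≡c1 = trans (slack₀ b q) (trans (cong (λ c → + c - + c1) q≡c1) (ℤP.+-inverseʳ (+ c1)))

      tight⇒c1 : ∀ {b q} → Tight s₀ b q → cost q ≡ c1
      tight⇒c1 {b} {q} tight = ℤP.+-injective (ℤP.i-j≡0⇒i≡j _ _ (trans (sym (slack₀ b q)) tight))

      no-tight-above : ∀ b q → E b q ≡ true → PrefA I b q (M₀ b) → ¬ Tight s₀ b q
      no-tight-above b q bq∈E q≻M₀b tight with init b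
      ... | inj₁ (_ , no-c1) = no-c1 q bq∈E (tight⇒c1 tight)
      ... | inj₂ (p , M₀b≡p , _ , _ , p-best) =
        ℕP.<-irrefl refl (ℕP.≤-<-trans (p-best q bq∈E (tight⇒c1 tight)) (subst (PrefA I b q) M₀b≡p q≻M₀b))

      outerInv : OuterInv s₀
      outerInv = record
        { inv = record
          { z-0-or-δ = λ _ _ _ → inj₁ refl
          ; c1≤y = λ _ → ℤP.≤-refl
          ; matching = matching
          ; zIn≤y-c1 = λ b q _ → ℤP.≤-reflexive (trans (zIn-zero {z s₀} b q (λ _ _ → refl)) (sym (ℤP.+-inverseʳ (+ c1))))
          ; matched-tight = matched-tight
          ; slack-0-or-δ = slack-0-or-δ
          ; unmatched-c2 = unmatched-c2 }
        ; every = λ b → (λ _ → refl , (λ _ _ → refl) , (λ _ _ → refl))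
                     , (λ q r bq∈E _ q≻r r≻M₀b → ⊥-elim ∘ no-tight-above b q bq∈E (pref-trans b (M₀ b) q≻r r≻M₀b)) }
        where
        matching : IsMatching I M₀
        matching b q M₀b≡q with init b
        ... | inj₁ (M₀b≡⊥ , _) = ⊥-elim (just≢nothing (trans (sym M₀b≡q) M₀b≡⊥))
        ... | inj₂ (p , M₀b≡p , bp∈E , _) with trans (sym M₀b≡p) M₀b≡q
        ...   | refl = bp∈E
        matched-tight : ∀ b q → M₀ b ≡ just q → Tight s₀ b q
        matched-tight b q M₀b≡q with init b
        ... | inj₁ (M₀b≡⊥ , _) = ⊥-elim (just≢nothing (trans (sym M₀b≡q) M₀b≡⊥))
        ... | inj₂ (p , M₀b≡p , _ , p≡c1 , _) with trans (sym M₀b≡p) M₀b≡q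
        ...   | refl = c1-tight p≡c1
        slack-0-or-δ : ∀ b q → E b q ≡ true → slack s₀ b q ≡ 0ℤ ⊎ slack s₀ b q ≡ δ
        slack-0-or-δ b q _ with cost∈ q
        ... | inj₁ q≡c1 = inj₁ (c1-tight q≡c1)
        ... | inj₂ q≡c2 = inj₂ (trans (slack₀ b q) (cong (λ c → + c - + c1) q≡c2))
        unmatched-c2 : ∀ b → M₀ b ≡ nothing → ∀ q → E b q ≡ true → cost q ≡ c2
        unmatched-c2 b M₀b≡⊥ q bq∈E with init b | cost∈ q
        ... | inj₂ (p , M₀b≡p , _) | _      = ⊥-elim (just≢nothing (trans (sym M₀b≡p) M₀b≡⊥))
        ... | inj₁ (_ , no-c1) | inj₁ q≡c1 = ⊥-elim (no-c1 q bq∈E q≡c1)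
        ... | inj₁ _           | inj₂ q≡c2 = q≡c2

      none : NoMatchable s₀
      none b q (bq∈E , _ , tight , _ , q≻M₀b , _) = no-tight-above b q bq∈E q≻M₀b tight

    -- Bounding c(M) and c(OPT) by Σ y

    costM-perfect : ∀ (O : Mat I) (o : Fin nA → Fin nP) → (∀ b → O b ≡ just (o b)) →
                    + costM I O ≡ sum (λ b → + cost (o b))
    costM-perfect O o O≡o = trans (ℕsum-allFin (λ b → maybe cost 0 (O b)))
                                  (sum-cong-≗ (λ b → cong (λ m → + maybe cost 0 m) (O≡o b)))

    +degree≡ : ∀ b → + degree I b ≡ sum (λ p → + (if E b p then 1 else 0))
    +degree≡ b = ℕsum-allFin (λ p → if E b p then 1 else 0)

    degree≥1 : ∀ {b q} → E b q ≡ true → 1 ℕ.≤ degree I b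
    degree≥1 {b} {q} bq∈E = ℤP.drop‿+≤+ (subst₂ _≤_ (cong (λ e → + (if e then 1 else 0)) bq∈E) (sym (+degree≡ b))
                                          (≤-∑ (λ _ → +≤+ z≤n) q))

    degree≤ℓA : ∀ b → degree I b ℕ.≤ ℓA I
    degree≤ℓA b = ≤-foldr-⊔ (∈-map⁺ (degree I) (∈-allFin b))

    ∑-lhs : ∀ s (o : Fin nA → Fin nP) → sum (λ b → lhs s b (o b)) ≡
            sum (y s) + sum (λ b → zOutBelow (z s) b (o b)) - sum (λ b → zIn (z s) b (o b))
    ∑-lhs s o = begin
      sum (λ b → lhs s b (o b))              ≡⟨ sum-cong-≗ (λ b → lhs≡ s b (o b)) ⟩
      sum (λ b → y s b + Out b - In b)       ≡⟨ ∑-distrib-sub (λ b → y s b + Out b) In ⟩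
      sum (λ b → y s b + Out b) - sum In     ≡⟨ cong (_- sum In) (∑-distrib-+ (y s) Out) ⟩
      sum (y s) + sum Out - sum In           ∎
      where
      open ≡-Reasoning
      Out : Fin nA → ℤ
      Out = λ b → zOutBelow (z s) b (o b)
      In : Fin nA → ℤ
      In = λ b → zIn (z s) b (o b)

    inTotal : DualZ → Fin nA → ℤ
    inTotal z b = sum (λ p → if E b p then zIn z b p else 0ℤ)

    outTotal : DualZ → Fin nA → ℤ
    outTotal z b = sum (λ p → if E b p then zOut z b p else 0ℤ)

    -- Both sides sum z over all valid triplets.
    ∑-outTotal≡∑-inTotal : ∀ z → sum (outTotal z) ≡ sum (inTotal z)
    ∑-outTotal≡∑-inTotal z = begin
      sum (outTotal z)                                  ≡⟨ sum-cong-≗ (λ b → sum-cong-≗ (λ p → sym (∑-if {nA} (E b p) _))) ⟩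
      sum (λ b → sum (λ p → sum (λ c → V b p c)))       ≡⟨ ∑-comm₃ V ⟩
      sum (λ c → sum (λ p → sum (λ b → V b p c)))
        ≡⟨ sum-cong-≗ (λ c → sum-cong-≗ (λ p → sum-cong-≗ (λ b → swap (E b p) (E c p) _ _))) ⟩
      sum (λ c → sum (λ p → sum (λ b → V′ c p b)))      ≡⟨ sum-cong-≗ (λ c → sum-cong-≗ (λ p → ∑-if {nA} (E c p) _)) ⟩
      sum (inTotal z)                                   ∎
      where
      open ≡-Reasoning
      V : Fin nA → Fin nP → Fin nA → ℤ
      V b p c = if E b p then (if E c p ∧ (rankP p b <ᵇ rankP p c) then z b p c else 0ℤ) else 0ℤ
      V′ : Fin nA → Fin nP → Fin nA → ℤ
      V′ c p b = if E c p then (if E b p ∧ (rankP p b <ᵇ rankP p c) then z b p c else 0ℤ) else 0ℤ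
      swap : ∀ x y r v → (if x then (if y ∧ r then v else 0ℤ) else 0ℤ) ≡ (if y then (if x ∧ r then v else 0ℤ) else 0ℤ)
      swap true  true  r v = refl
      swap true  false r v = refl
      swap false true  r v = refl
      swap false false r v = refl

    module Accounting (c1≤c2 : c1 ℕ.≤ c2) {s : State} (J : Inv s) where
      open Inv J

      z≥0 : ∀ b q c → 0ℤ ≤ z s b q c
      z≥0 b q c with z-0-or-δ b q c
      ... | inj₁ z≡0 = ℤP.≤-reflexive (sym z≡0)
      ... | inj₂ z≡δ = subst (0ℤ ≤_) (sym z≡δ) (0≤δ c1≤c2)

      lhs≤cost : ∀ b q → E b q ≡ true → lhs s b q ≤ + cost q
      lhs≤cost b q bq∈E = ℤP.0≤i-j⇒j≤i (0≤slack (slack-0-or-δ b q bq∈E))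
        where
        0≤slack : slack s b q ≡ 0ℤ ⊎ slack s b q ≡ δ → 0ℤ ≤ slack s b q
        0≤slack (inj₁ slack≡0) = ℤP.≤-reflexive (sym slack≡0)
        0≤slack (inj₂ slack≡δ) = subst (0ℤ ≤_) (sym slack≡δ) (0≤δ c1≤c2)

      -- Envy-freeness turns a ≻_{o b} b into o b ⪯_a o a, so each z_{a,o b,b} counted in
      -- zIn b (o b) is also counted in zOutBelow a (o a).
      module EnvyFreeBound (O : Mat I) (o : Fin nA → Fin nP) (O≡o : ∀ b → O b ≡ just (o b))
                           (bo∈E : ∀ b → E b (o b) ≡ true) (envy-free : EnvyFree I O) where

        envied-below : ∀ a b → E a (o b) ≡ true → rankP (o b) a ℕ.< rankP (o b) b → atOrBelowᵇ a (o a) (o b) ≡ true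
        envied-below a b a-ob∈E a≻b with ℕP.<-cmp (rankA a (o b)) (rankA a (o a))
        ... | tri< ob≻oa _ _ = ⊥-elim (envy-free b (o b) a (O≡o b) a-ob∈E a≻b (subst (PrefA I a (o b)) (sym (O≡o a)) ob≻oa))
        ... | tri≈ _ ob≈oa _ = atOrBelow-intro a-ob∈E (inj₁ (rankA-inj a (o b) (o a) a-ob∈E (bo∈E a) ob≈oa))
        ... | tri> _ _ oa≻ob = atOrBelow-intro a-ob∈E (inj₂ oa≻ob)

        zInTerm : Fin nA → Fin nA → ℤ
        zInTerm a b = if E a (o b) ∧ (rankP (o b) a <ᵇ rankP (o b) b) then z s a (o b) b else 0ℤ

        zOutTerm : Fin nA → Fin nP → Fin nA → ℤ
        zOutTerm a p b = if atOrBelowᵇ a (o a) p then (if E b p ∧ (rankP p a <ᵇ rankP p b) then z s a p b else 0ℤ) else 0ℤ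

        zOutTerm≥0 : ∀ a p b → 0ℤ ≤ zOutTerm a p b
        zOutTerm≥0 a p b = guarded-nonneg (atOrBelowᵇ a (o a) p) (guarded-nonneg (E b p ∧ (rankP p a <ᵇ rankP p b)) (z≥0 a p b))

        zInTerm≤zOutTerm : ∀ a b → zInTerm a b ≤ zOutTerm a (o b) b
        zInTerm≤zOutTerm a b with E a (o b) ∧ (rankP (o b) a <ᵇ rankP (o b) b) in envies
        ... | false = zOutTerm≥0 a (o b) b
        ... | true = envied (∧-conicalˡ _ _ envies) (∧-conicalʳ (E a (o b)) _ envies)
          where
          envied : E a (o b) ≡ true → (rankP (o b) a <ᵇ rankP (o b) b) ≡ true → z s a (o b) b ≤ zOutTerm a (o b) b
          envied a-ob∈E a≻b rewrite envied-below a b a-ob∈E (<ᵇ-sound a≻b) | bo∈E b | a≻b = ℤP.≤-refl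

        ∑-zIn≤∑-zOutBelow : sum (λ b → zIn (z s) b (o b)) ≤ sum (λ a → zOutBelow (z s) a (o a))
        ∑-zIn≤∑-zOutBelow = begin
          sum (λ b → sum (λ a → zInTerm a b))                      ≡⟨ ∑-comm (λ b a → zInTerm a b) ⟩
          sum (λ a → sum (λ b → zInTerm a b))
            ≤⟨ ∑-mono-≤ (λ a → ∑-mono-≤ (λ b → ℤP.≤-trans (zInTerm≤zOutTerm a b) (≤-∑ (λ p → zOutTerm≥0 a p b) (o b)))) ⟩
          sum (λ a → sum (λ b → sum (λ p → zOutTerm a p b)))        ≡⟨ sum-cong-≗ (λ a → ∑-comm (λ b p → zOutTerm a p b)) ⟩
          sum (λ a → sum (λ p → sum (λ b → zOutTerm a p b)))
            ≡⟨ sum-cong-≗ (λ a → sum-cong-≗ (λ p → ∑-if {nA} (atOrBelowᵇ a (o a) p) _)) ⟩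
          sum (λ a → zOutBelow (z s) a (o a))                ∎
          where open ℤP.≤-Reasoning

      weak-duality : ∀ O → IsMatching I O → APerfect I O → EnvyFree I O → sum (y s) ≤ + costM I O
      weak-duality O O-matching O-perfect envy-free = begin
        sum (y s)
          ≤⟨ ℤP.i≤i+j (sum (y s)) _ ⦃ ℤ.nonNegative (ℤP.i≤j⇒0≤j-i ∑-zIn≤∑-zOutBelow) ⦄ ⟩
        sum (y s) + (sum Out - sum In)               ≡⟨ ℤP.+-assoc (sum (y s)) (sum Out) (ℤ.- sum In) ⟨
        sum (y s) + sum Out - sum In                 ≡⟨ ∑-lhs s o ⟨
        sum (λ b → lhs s b (o b))                    ≤⟨ ∑-mono-≤ (λ b → lhs≤cost b (o b) (bo∈E b)) ⟩
        sum (λ b → + cost (o b))                     ≡⟨ costM-perfect O o O≡o ⟨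
        + costM I O                                  ∎
        where
        open ℤP.≤-Reasoning
        o : Fin nA → Fin nP
        o b = proj₁ (O-perfect b)
        O≡o : ∀ b → O b ≡ just (o b)
        O≡o b = proj₂ (O-perfect b)
        bo∈E : ∀ b → E b (o b) ≡ true
        bo∈E b = O-matching b (o b) (O≡o b)
        open EnvyFreeBound O o O≡o bo∈E envy-free
        Out : Fin nA → ℤ
        Out = λ b → zOutBelow (z s) b (o b)
        In : Fin nA → ℤ
        In = λ b → zIn (z s) b (o b)

      zOutBelow≤outTotal : ∀ b q → zOutBelow (z s) b q ≤ outTotal (z s) b
      zOutBelow≤outTotal b q = ∑-mono-≤ term
        where
        term : ∀ p → (if atOrBelowᵇ b q p then zOut (z s) b p else 0ℤ) ≤ (if E b p then zOut (z s) b p else 0ℤ)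
        term p with E b p | ⌊ p Fin.≟ q ⌋ ∨ (rankA b q <ᵇ rankA b p)
        ... | false | _     = ℤP.≤-refl
        ... | true  | true  = ℤP.≤-refl
        ... | true  | false = ∑-nonneg (λ c → guarded-nonneg _ (z≥0 b p c))

      module _ (perfect : APerfect I (M s)) where

        m : Fin nA → Fin nP
        m b = proj₁ (perfect b)

        M≡m : ∀ b → M s b ≡ just (m b)
        M≡m b = proj₂ (perfect b)

        bm∈E : ∀ b → E b (m b) ≡ true
        bm∈E b = matching b (m b) (M≡m b)

        inTotal-bound : ∀ b → inTotal (z s) b - zIn (z s) b (m b) ≤ + degree I b * (y s b - + c1) - (y s b - + c1)
        inTotal-bound b = subst₂ _≤_ (cong (λ t → inTotal (z s) b - t) f-at-m) (cong₂ _-_ ∑g≡ g-at-m)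
          (∑-minus-term-mono-≤ f≤g (m b))
          where
          k : ℤ
          k = y s b - + c1
          f : Fin nP → ℤ
          f p = if E b p then zIn (z s) b p else 0ℤ
          g : Fin nP → ℤ
          g p = + (if E b p then 1 else 0) * k
          f≤g : ∀ p → f p ≤ g p
          f≤g p with E b p in bp∈E
          ... | true  = subst (zIn (z s) b p ≤_) (sym (ℤP.*-identityˡ k)) (zIn≤y-c1 b p bp∈E)
          ... | false = ℤP.≤-refl
          f-at-m : f (m b) ≡ zIn (z s) b (m b)
          f-at-m = cong (λ e → if e then zIn (z s) b (m b) else 0ℤ) (bm∈E b)
          g-at-m : g (m b) ≡ k
          g-at-m = trans (cong (λ e → + (if e then 1 else 0) * k) (bm∈E b)) (ℤP.*-identityˡ k)
          ∑g≡ : sum g ≡ + degree I b * k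
          ∑g≡ = trans (sym (*-distribʳ-sum k (λ p → + (if E b p then 1 else 0)))) (cong (_* k) (sym (+degree≡ b)))

        upper-bound : + costM I (M s) ≤ + ℓA I * sum (y s)
        upper-bound = begin
          + costM I (M s)                                 ≡⟨ costM-perfect (M s) m M≡m ⟩
          sum (λ b → + cost (m b))
            ≡⟨ sum-cong-≗ (λ b → ℤP.i-j≡0⇒i≡j _ _ (matched-tight b (m b) (M≡m b))) ⟩
          sum (λ b → lhs s b (m b))                       ≡⟨ ∑-lhs s m ⟩
          sum (y s) + sum Out - sum In
            ≤⟨ ℤP.+-monoˡ-≤ (ℤ.- sum In) (ℤP.+-monoʳ-≤ (sum (y s)) ∑Out≤∑inTotal) ⟩
          sum (y s) + sum (inTotal (z s)) - sum In        ≡⟨ regroup ⟨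
          sum (λ b → y s b + (inTotal (z s) b - In b))    ≤⟨ ∑-mono-≤ per-agent ⟩
          sum (λ b → + ℓA I * y s b)                      ≡⟨ *-distribˡ-sum (+ ℓA I) (y s) ⟨
          + ℓA I * sum (y s)                              ∎
          where
          open ℤP.≤-Reasoning
          Out : Fin nA → ℤ
          Out = λ b → zOutBelow (z s) b (m b)
          In : Fin nA → ℤ
          In = λ b → zIn (z s) b (m b)
          ∑Out≤∑inTotal : sum Out ≤ sum (inTotal (z s))
          ∑Out≤∑inTotal = ℤP.≤-trans (∑-mono-≤ (λ b → zOutBelow≤outTotal b (m b))) (ℤP.≤-reflexive (∑-outTotal≡∑-inTotal (z s)))
          regroup : sum (λ b → y s b + (inTotal (z s) b - In b)) ≡ sum (y s) + sum (inTotal (z s)) - sum In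
          regroup = trans (∑-distrib-+ (y s) _) (trans (cong (λ t → sum (y s) + t) (∑-distrib-sub (inTotal (z s)) In))
                          (sym (ℤP.+-assoc (sum (y s)) _ _)))
          per-agent : ∀ b → y s b + (inTotal (z s) b - In b) ≤ + ℓA I * y s b
          per-agent b = ℤP.≤-trans (ℤP.+-monoʳ-≤ (y s b) (inTotal-bound b))
                                   (degree-weighted-bound (c1≤y b) (degree≥1 (bm∈E b)) (degree≤ℓA b))

open import Data.Nat using (ℕ; _<_; _≤_; _*_)
open import Data.Nat.Properties using (<⇒≤)
open import Data.Fin using (Fin)
open import Data.Bool using (true)
open import Data.Sum using (_⊎_)
open import Data.Product using (∃; _×_; _,_; proj₁; proj₂)
open import Relation.Binary.PropositionalEquality using (_≡_)
import Data.Integer as ℤ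
import Data.Integer.Properties as ℤP
open import Algebra.Properties.Semiring.Sum ℤP.+-*-semiring using (sum)
open PrimalDualAnalysis

mainTheorem3 : (I : Instance) (c1 c2 : ℕ) → c1 < c2 →
    (∀ p → Instance.cost I p ≡ c1 ⊎ Instance.cost I p ≡ c2) →
    (∀ a → ∃ λ p → Instance.E I a p ≡ true) →
    (s : Alg.State I c1 c2) → Alg.AlgRun I c1 c2 s →
    (OPT : Mat I) → IsOPT I OPT →
    costM I (Alg.M s) ≤ ℓA I * costM I OPT
mainTheorem3 I c1 c2 c1<c2 cost∈ _ s (M₀ , init , run) OPT (OPT-matching , OPT-perfect , OPT-envy-free , _) =
  ℤP.drop‿+≤+ (begin
    ℤ.+ costM I (Alg.M s)            ≤⟨ upper-bound perfect ⟩
    ℤ.+ ℓA I ℤ.* sum (Alg.y s)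
      ≤⟨ ℤP.*-monoˡ-≤-nonNeg (ℤ.+ ℓA I) (weak-duality OPT OPT-matching OPT-perfect OPT-envy-free) ⟩
    ℤ.+ ℓA I ℤ.* ℤ.+ costM I OPT     ≡⟨ ℤP.pos-* (ℓA I) (costM I OPT) ⟨
    ℤ.+ (ℓA I * costM I OPT)         ∎)
  where
  open ℤP.≤-Reasoning
  open Initial I c1 c2 cost∈ M₀ init
  c1≤c2 : c1 ≤ c2
  c1≤c2 = <⇒≤ c1<c2
  final : OuterInv I c1 c2 s × APerfect I (Alg.M s)
  final = outer-loop I c1 c2 c1≤c2 outerInv none run
  perfect : APerfect I (Alg.M s)
  perfect = proj₂ final
  open Accounting I c1 c2 c1≤c2 (OuterInv.inv (proj₁ final))
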